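{- Let $N=(S,T,F,M_0,\ell)$ be a structural conflict net. If there are $\sigma\in\mathrm{Act}^*$ and $a,b,c\in\mathrm{Act}$ with $a\ne c$ such that $\langle\sigma,\{\{a,c\}\}\rangle\notin\mathcal F(N)$, $\langle\sigma,\{\{b\}\}\rangle\notin\mathcal F(N)$ and $\langle\sigma,\{\{a,b\},\{b,c\}\}\rangle\in\mathcal F(N)$, then $N$ has a fully reachable pure M.
   Context: Fix $\mathrm{Act}$, $\tau\notin\mathrm{Act}$. Petri net $N=(S,T,F,M_0,\ell)$, $\ell:T\to\mathrm{Act}\cup\{\tau\}$; ${}^\bullet x(y)=F(y,x)$; $M[G\rangle M'$ iff ${}^\bullet G\le M$, $M'=M-{}^\bullet G+G^\bullet$; $t\smile u$ iff some reachable marking enables $\{t\}+\{u\}$. Structural conflict net: $t\smile u\Rightarrow{}^\bullet t\cap{}^\bullet u=\emptyset$. Fully reachable pure M: $t,u,v\in T$ with ${}^\bullet t\cap{}^\bullet u\ne\emptyset$, ${}^\bullet u\cap{}^\bullet v\ne\emptyset$, ${}^\bullet t\cap{}^\bullet v=\emptyset$ and a reachable $M\ge{}^\bullet t\cup{}^\bullet u\cup{}^\bullet v$. Step failures: $M\xrightarrow{a}M'$ iff $M[t\rangle M'$ with $\ell(t)=a$; $\Rightarrow$ reflexive transitive closure of $\xrightarrow{\tau}$; $M\stackrel{a_1\cdots a_n}{\Longrightarrow}M'$ means $M\Rightarrow\xrightarrow{a_1}\Rightarrow\cdots\xrightarrow{a_n}\Rightarrow M'$; for a nonempty finite multiset $A$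 over $\mathrm{Act}$, $M\xrightarrow{A}$ iff $M[G\rangle$ for some $G$ with $\ell(G)=A$. $\mathcal F(N)$ is the set of pairs $\langle\sigma,X\rangle$ ($\sigma\in\mathrm{Act}^*$, $X$ finite set of nonempty finite multisets over $\mathrm{Act}$) such that some $M$ has $M_0\stackrel{\sigma}{\Longrightarrow}M$, $M\not\xrightarrow{\tau}$ and $M\not\xrightarrow{A}$ for all $A\in X$. -}

module Defs where

open import Data.Nat using (ℕ; _≤_; _+_; _∸_; _>_)
open import Data.List using (List; []; _∷_; map)
open import Data.Nat.ListAction using (sum)
open import Data.List.Membership.Propositional using (_∈_)
open import Data.List.Relation.Binary.Permutation.Propositional using (_↭_)
open import Data.Maybe using (Maybe; just; nothing)
open import Data.Product using (Σ; ∃; _×_; _,_)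
open import Relation.Binary.PropositionalEquality using (_≡_)
open import Relation.Binary.Construct.Closure.ReflexiveTransitive using (Star)
open import Relation.Nullary using (¬_)

-- The flow function F : (S×T ∪ T×S) → ℕ is split into
--   pre  s t = F(s,t)   and   post t s = F(t,s).
-- The label ℓ t = nothing encodes ℓ(t) = τ (τ ∉ Act), ℓ t = just a encodes ℓ(t) = a.
record Net (Act : Set) : Set₁ where
  field
    S    : Set
    T    : Set
    pre  : S → T → ℕ
    post : T → S → ℕ
    M₀   : S → ℕ
    ℓ    : T → Maybe Act

module _ {Act : Set} (N : Net Act) where
  open Net N

  Marking : Set
  Marking = S → ℕ

  -- finite multisets of transitions are represented by lists (order irrelevant)
  -- •G (s) = Σ_{t ∈ G} F(s,t),   G• (s) = Σ_{t ∈ G} F(t,s)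
  •_ : List T → Marking
  (• G) s = sum (map (λ t → pre s t) G)

  _• : List T → Marking
  (G •) s = sum (map (λ t → post t s) G)

  Enabled : Marking → List T → Set
  Enabled M G = ∀ s → (• G) s ≤ M s

  Fires : Marking → List T → Marking → Set
  Fires M G M' = Enabled M G × (∀ s → M' s ≡ (M s ∸ (• G) s) + (G •) s)

  Step : Marking → Marking → Set
  Step M M' = ∃ λ (G : List T) → Fires M G M'

  Reachable : Marking → Set
  Reachable M = Star Step M₀ M

  _⌣_ : T → T → Set
  t ⌣ u = ∃ λ M → Reachable M × Enabled M (t ∷ u ∷ [])

  PresetsMeet : T → T → Set
  PresetsMeet t u = ∃ λ s → pre s t > 0 × pre s u > 0

  StructuralConflictNet : Set
  StructuralConflictNet = ∀ t u → t ⌣ u → ¬ PresetsMeet t u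

  HasFullyReachablePureM : Set
  HasFullyReachablePureM =
    ∃ λ t → ∃ λ u → ∃ λ v →
      PresetsMeet t u × PresetsMeet u v × ¬ PresetsMeet t v ×
      (∃ λ M → Reachable M ×
        (∀ s → pre s t ≤ M s × pre s u ≤ M s × pre s v ≤ M s))

  _─[_]→_ : Marking → Act → Marking → Set
  M ─[ a ]→ M' = ∃ λ t → ℓ t ≡ just a × Fires M (t ∷ []) M'

  _─τ→_ : Marking → Marking → Set
  M ─τ→ M' = ∃ λ t → ℓ t ≡ nothing × Fires M (t ∷ []) M'

  data _═[_]⇒_ : Marking → List Act → Marking → Set where
    done : ∀ {M} → M ═[ [] ]⇒ M
    τ∷   : ∀ {M M' M'' σ} → M ─τ→ M' → M' ═[ σ ]⇒ M'' → M ═[ σ ]⇒ M''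
    vis∷ : ∀ {M M' M'' a σ} → M ─[ a ]→ M' → M' ═[ σ ]⇒ M'' → M ═[ a ∷ σ ]⇒ M''

  τEnabled : Marking → Set
  τEnabled M = ∃ λ M' → M ─τ→ M'

  -- M --A--> for a finite multiset A over Act (represented as a list):
  -- some step G with ℓ(G) = A (as multisets; τ-labelled transitions excluded)
  StepEnabled : Marking → List Act → Set
  StepEnabled M A = ∃ λ (G : List T) → Enabled M G × (map ℓ G ↭ map just A)

  StepFailure : List Act → List (List Act) → Set
  StepFailure σ X =
    ∃ λ M → (M₀ ═[ σ ]⇒ M) × ¬ τEnabled M × (∀ A → A ∈ X → ¬ StepEnabled M A)

-- At a stable marking M reached after σ, the failures that are excluded give a
-- b-labelled transition t and an enabled step {u, v} labelled {a, c}.  By structural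
-- conflict-freeness •u ∩ •v = ∅.  Since M refuses {a, b} and {b, c}, neither {u, t}
-- nor {t, v} is enabled although each of u, t, v is; a step of two individually
-- enabled transitions with disjoint presets is enabled, so •u ∩ •t ≠ ∅ and
-- •t ∩ •v ≠ ∅.  M covers all three presets, which gives the pure M u, t, v.
module Submission where

open import Defs
open import Data.List using (List; []; _∷_; _++_; map)
open import Data.List.Properties using (map-++; ∷-injectiveˡ; ∷-injectiveʳ)
open import Data.Nat using (zero; suc; _+_; _≤_; _>_; z≤n; s≤s)
open import Data.Nat.Properties using (≤-trans; m≤m+n; m≤n+m; +-identityʳ)
open import Data.Nat.ListAction using (sum)
open import Data.Nat.ListAction.Properties using (sum-++; sum-↭)
open import Data.Empty using (⊥-elim)
open import Data.Maybe using (just)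
open import Data.Product using (∃; ∃₂; _×_; _,_; proj₁; proj₂)
open import Data.List.Relation.Unary.Any using (here; there)
open import Data.List.Relation.Binary.Permutation.Propositional using (_↭_; ↭-reflexive)
open import Data.List.Relation.Binary.Permutation.Propositional.Properties using (map⁺; ↭-map-inv)
open import Relation.Binary.PropositionalEquality using (_≡_; _≢_; refl; sym; trans; cong; cong₂; subst)
open import Relation.Binary.Construct.Closure.ReflexiveTransitive using (Star; ε; _◅_)
open import Relation.Nullary using (¬_)
open import Level using (0ℓ)
open import Axiom.ExcludedMiddle using (ExcludedMiddle)
open import Axiom.DoubleNegationElimination using (DoubleNegationElimination; em⇒dne)

module _ {Act : Set} (N : Net Act) where
  open Net N

  ═⇒-steps : ∀ {M M′ σ} → _═[_]⇒_ N M σ M′ → Star (Step N) M M′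
  ═⇒-steps done               = ε
  ═⇒-steps (τ∷ (t , _ , f) p)   = (t ∷ [] , f) ◅ ═⇒-steps p
  ═⇒-steps (vis∷ (t , _ , f) p) = (t ∷ [] , f) ◅ ═⇒-steps p

  •-++ : ∀ G H s → (• N) (G ++ H) s ≡ (• N) G s + (• N) H s
  •-++ G H s = trans (cong sum (map-++ (λ t → pre s t) G H))
                      (sum-++ (map (λ t → pre s t) G) (map (λ t → pre s t) H))

  •-resp-↭ : ∀ {G H} → G ↭ H → ∀ s → (• N) G s ≡ (• N) H s
  •-resp-↭ G↭H s = sum-↭ (map⁺ (λ t → pre s t) G↭H)

  Enabled-resp-↭ : ∀ {M G H} → G ↭ H → Enabled N M G → Enabled N M H
  Enabled-resp-↭ {M} G↭H en s = subst (_≤ M s) (•-resp-↭ G↭H s) (en s)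

  Enabled-++⁻ : ∀ {M} G H → Enabled N M (G ++ H) → Enabled N M G × Enabled N M H
  Enabled-++⁻ G H en =
    (λ s → ≤-trans (m≤m+n _ _) (subst (_≤ _) (•-++ G H s) (en s))) ,
    (λ s → ≤-trans (m≤n+m _ _) (subst (_≤ _) (•-++ G H s) (en s)))

  Enabled-singleton⇒pre≤ : ∀ {M t} → Enabled N M (t ∷ []) → ∀ s → pre s t ≤ M s
  Enabled-singleton⇒pre≤ {M} {t} en s = subst (_≤ M s) (+-identityʳ (pre s t)) (en s)

  Enabled-disjoint-pair : ∀ {M t u} → Enabled N M (t ∷ []) → Enabled N M (u ∷ []) →
                          ¬ PresetsMeet N t u → Enabled N M (t ∷ u ∷ [])
  Enabled-disjoint-pair {M} {t} {u} en-t en-u disjoint s with pre s t in eq-t | pre s u in eq-u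
  ... | zero  | _     = subst (λ n → n + 0 ≤ M s) eq-u (en-u s)
  ... | suc _ | zero  = subst (λ n → n + 0 ≤ M s) eq-t (en-t s)
  ... | suc _ | suc _ =
    ⊥-elim (disjoint (s , subst (_> 0) (sym eq-t) (s≤s z≤n) , subst (_> 0) (sym eq-u) (s≤s z≤n)))

  PresetsMeet-of-disabled-pair : DoubleNegationElimination 0ℓ → ∀ {M t u} →
    Enabled N M (t ∷ []) → Enabled N M (u ∷ []) → ¬ Enabled N M (t ∷ u ∷ []) → PresetsMeet N t u
  PresetsMeet-of-disabled-pair dne en-t en-u ¬en-tu =
    dne (λ disjoint → ¬en-tu (Enabled-disjoint-pair en-t en-u disjoint))

  fully-reachable-pure-M : DoubleNegationElimination 0ℓ → StructuralConflictNet N →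
    ∀ {M t u v} → Reachable N M → Enabled N M (t ∷ []) → Enabled N M (u ∷ v ∷ []) →
    ¬ Enabled N M (u ∷ t ∷ []) → ¬ Enabled N M (t ∷ v ∷ []) → HasFullyReachablePureM N
  fully-reachable-pure-M dne scn {M} {t} {u} {v} reach en-t en-uv ¬en-ut ¬en-tv =
    u , t , v ,
    PresetsMeet-of-disabled-pair dne en-u en-t ¬en-ut ,
    PresetsMeet-of-disabled-pair dne en-t en-v ¬en-tv ,
    scn u v (M , reach , en-uv) ,
    M , reach , λ s → Enabled-singleton⇒pre≤ en-u s , Enabled-singleton⇒pre≤ en-t s ,
                      Enabled-singleton⇒pre≤ en-v s
    where
      en-u : Enabled N M (u ∷ [])
      en-u = proj₁ (Enabled-++⁻ (u ∷ []) (v ∷ []) en-uv)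
      en-v : Enabled N M (v ∷ [])
      en-v = proj₂ (Enabled-++⁻ (u ∷ []) (v ∷ []) en-uv)

  StepEnabled⇒labelled-step : ∀ {M A} → StepEnabled N M A →
    ∃ λ G → Enabled N M G × map ℓ G ≡ map just A
  StepEnabled⇒labelled-step (G , en , ℓG↭A) with G′ , A≡ℓG′ , G↭G′ ← ↭-map-inv ℓ ℓG↭A =
    G′ , Enabled-resp-↭ G↭G′ en , sym A≡ℓG′

  singleton-step : ∀ {M x} → StepEnabled N M (x ∷ []) →
    ∃ λ t → ℓ t ≡ just x × Enabled N M (t ∷ [])
  singleton-step en with StepEnabled⇒labelled-step en
  ... | t ∷ [] , en-t , ℓt = t , ∷-injectiveˡ ℓt , en-t
  ... | [] , _ , ()
  ... | _ ∷ _ ∷ _ , _ , ()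

  pair-step : ∀ {M x y} → StepEnabled N M (x ∷ y ∷ []) →
    ∃₂ λ u v → ℓ u ≡ just x × ℓ v ≡ just y × Enabled N M (u ∷ v ∷ [])
  pair-step en with StepEnabled⇒labelled-step en
  ... | u ∷ v ∷ [] , en-uv , ℓuv = u , v , ∷-injectiveˡ ℓuv , ∷-injectiveˡ (∷-injectiveʳ ℓuv) , en-uv
  ... | [] , _ , ()
  ... | _ ∷ [] , _ , ()
  ... | _ ∷ _ ∷ _ ∷ _ , _ , ()

  pair-StepEnabled : ∀ {M u v x y} → ℓ u ≡ just x → ℓ v ≡ just y →
    Enabled N M (u ∷ v ∷ []) → StepEnabled N M (x ∷ y ∷ [])
  pair-StepEnabled {u = u} {v} ℓu ℓv en-uv =
    u ∷ v ∷ [] , en-uv , ↭-reflexive (cong₂ _∷_ ℓu (cong₂ _∷_ ℓv refl))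

  StepEnabled-of-¬StepFailure : DoubleNegationElimination 0ℓ → ∀ {σ M A} →
    _═[_]⇒_ N M₀ σ M → ¬ τEnabled N M → ¬ StepFailure N σ (A ∷ []) → StepEnabled N M A
  StepEnabled-of-¬StepFailure dne {M = M} M₀⇒M stable ¬failure =
    dne (λ ¬en → ¬failure (M , M₀⇒M , stable , λ { _ (here refl) → ¬en ; _ (there ()) }))

lemma5p5 : ExcludedMiddle 0ℓ →
    {Act : Set} (N : Net Act) → StructuralConflictNet N →
    (σ : List Act) (a b c : Act) → a ≢ c →
    ¬ StepFailure N σ ((a ∷ c ∷ []) ∷ []) →
    ¬ StepFailure N σ ((b ∷ []) ∷ []) →
    StepFailure N σ ((a ∷ b ∷ []) ∷ (b ∷ c ∷ []) ∷ []) →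
    HasFullyReachablePureM N
lemma5p5 em N scn σ a b c _ ¬F[ac] ¬F[b] (M , M₀⇒M , stable , refuses)
  with singleton-step N (StepEnabled-of-¬StepFailure N (em⇒dne em) M₀⇒M stable ¬F[b])
     | pair-step N (StepEnabled-of-¬StepFailure N (em⇒dne em) M₀⇒M stable ¬F[ac])
... | t , ℓt , en-t | u , v , ℓu , ℓv , en-uv =
  fully-reachable-pure-M N (em⇒dne em) scn (═⇒-steps N M₀⇒M) en-t en-uv
    (λ en-ut → refuses (a ∷ b ∷ []) (here refl) (pair-StepEnabled N ℓu ℓt en-ut))
    (λ en-tv → refuses (b ∷ c ∷ []) (there (here refl)) (pair-StepEnabled N ℓt ℓv en-tv))
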